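{- Let $P$ be an $n$-element poset, $L$ a labeling of $P$, and $x_0\in P$. Let $\tilde P=P\setminus\{x_0\}$ (with the induced order) and $\tilde L=\mathrm{st}(L|_{\tilde P})$, a labeling of $\tilde P$ by $[n-1]$. Suppose $x_0$ is not in the promotion chain of any of $L_0,L_1,\ldots,L_{\gamma-1}$. Then $\mathrm{st}(L_\gamma|_{\tilde P})=\tilde L_\gamma$, where $\tilde L_\gamma$ denotes $\gamma$ applications of extended promotion on $\tilde P$ to $\tilde L$.
   Context: A labeling of an $m$-element poset is a bijection onto $[m]$. Extended promotion $\partial$ on an $m$-element poset: for a labeling $L$, the promotion chain is $v_1=L^{ -1}(1)$, and $v_{i+1}$ is the element above $v_i$ with smallest label, stopping at the first maximal element $v_m'$; then $\partial(L)(x)=L(x)-1$ for $x$ off the chain, $\partial(L)(v_i)=L(v_{i+1})-1$ for non-final chain elements $v_i$, and the final chain element gets label $m$. Write $L_\gamma=\partial^\gamma(L)$, $L_0=L$. For an injective $f:Y\to\mathbb{Z}$ on an $m$-element set, the standardization $\mathrm{st}(f)$ is the unique bijection $g:Y\to[m]$ with $g(y)<g(y')$ iff $f(y)<f(y')$. -}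

module Defs where

open import Data.Nat using (ℕ; zero; suc; _∸_; _≤_; _<_; _<?_)
open import Data.Fin using (Fin; punchIn) renaming (_≟_ to _≟F_)
open import Data.Fin.Properties using (punchIn-injective)
open import Data.List using (List; []; _∷_; allFin; filter; length)
open import Data.Maybe using (Maybe; just; nothing)
open import Data.Product using (_×_; _,_; ∃)
open import Data.Bool using (if_then_else_)
open import Function using (Injective)
open import Relation.Binary using (IsDecPartialOrder; IsPartialOrder; IsPreorder)
open import Relation.Nullary using (¬_; yes; no; does)
open import Relation.Binary.PropositionalEquality using (_≡_; refl; cong; isEquivalence)

record FinPoset (n : ℕ) : Set₁ where
  field
    _≼_ : Fin n → Fin n → Set
    isDecPartialOrder : IsDecPartialOrder _≡_ _≼_
  open IsDecPartialOrder isDecPartialOrder public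
    using (_≤?_; antisym; trans; reflexive)

IsLabeling : (m : ℕ) → (Fin m → ℕ) → Set
IsLabeling m L =
  Injective _≡_ _≡_ L
  × (∀ x → 1 ≤ L x × L x ≤ m)
  × (∀ k → 1 ≤ k → k ≤ m → ∃ λ x → L x ≡ k)

module Promotion {n : ℕ} (P : FinPoset n) where
  open FinPoset P

  findFirst : (Fin n → Data.Bool.Bool) → List (Fin n) → Maybe (Fin n)
  findFirst p [] = nothing
  findFirst p (x ∷ xs) = if p x then just x else findFirst p xs

  labelOne : (Fin n → ℕ) → Maybe (Fin n)
  labelOne L = findFirst (λ x → does (L x Data.Nat.≟ 1)) (allFin n)

  above? : Fin n → Fin n → Data.Bool.Bool
  above? v y with v ≤? y | v ≟F y
  ... | yes _ | no _ = Data.Bool.true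
  ... | _     | _    = Data.Bool.false

  minAboveIn : (Fin n → ℕ) → Fin n → List (Fin n) → Maybe (Fin n)
  minAboveIn L v [] = nothing
  minAboveIn L v (y ∷ ys) with above? v y | minAboveIn L v ys
  ... | Data.Bool.false | r = r
  ... | Data.Bool.true  | nothing = just y
  ... | Data.Bool.true  | just z = if does (L y <? L z) then just y else just z

  minAbove : (Fin n → ℕ) → Fin n → Maybe (Fin n)
  minAbove L v = minAboveIn L v (allFin n)

  -- The fuel argument is n, which is always
  -- sufficient since the chain is strictly increasing in an n-element poset.
  chainFrom : (Fin n → ℕ) → ℕ → Fin n → List (Fin n)
  chainFrom L zero v = v ∷ []
  chainFrom L (suc k) v with minAbove L v
  ... | nothing = v ∷ []
  ... | just w  = v ∷ chainFrom L k w

  chain : (Fin n → ℕ) → List (Fin n)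
  chain L with labelOne L
  ... | nothing = []
  ... | just v₁ = chainFrom L n v₁

  relabel : (Fin n → ℕ) → List (Fin n) → Fin n → ℕ
  relabel L [] x = L x ∸ 1
  relabel L (v ∷ []) x = if does (v ≟F x) then n else L x ∸ 1
  relabel L (v ∷ w ∷ vs) x = if does (v ≟F x) then L w ∸ 1 else relabel L (w ∷ vs) x

  ∂ : (Fin n → ℕ) → (Fin n → ℕ)
  ∂ L = relabel L (chain L)

  ∂^ : ℕ → (Fin n → ℕ) → (Fin n → ℕ)
  ∂^ zero L = L
  ∂^ (suc γ) L = ∂ (∂^ γ L)

open Promotion public using (chain; ∂; ∂^)

st : {m : ℕ} → (Fin m → ℕ) → (Fin m → ℕ)
st {m} f y = suc (length (filter (λ y′ → f y′ <? f y) (allFin m)))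

-- The subposet P \ {x₀} with the induced order, with ground set Fin n'
-- embedded into Fin (suc n') via punchIn x₀ (a bijection onto P \ {x₀}).

deletePt : {n' : ℕ} → FinPoset (suc n') → Fin (suc n') → FinPoset n'
deletePt {n'} P x₀ = record
  { _≼_ = λ i j → punchIn x₀ i ≼ punchIn x₀ j
  ; isDecPartialOrder = record
    { isPartialOrder = record
      { isPreorder = record
        { isEquivalence = isEquivalence
        ; reflexive = λ { refl → reflexive refl }
        ; trans = trans
        }
      ; antisym = λ p q → punchIn-injective x₀ _ _ (antisym p q)
      }
    ; _≟_ = _≟F_
    ; _≤?_ = λ i j → punchIn x₀ i ≤? punchIn x₀ j
    }
  }
  where open FinPoset P

{-# OPTIONS --safe #-}

-- Extended promotion only ever compares labels: the chain starts at the element labelled 1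
-- and repeatedly moves to the least-labelled element strictly above, and ∂ then gives each
-- element the label of its chain successor minus one (the top label for the last one, the own
-- label minus one off the chain).  Hence if L_γ restricted to P \ {x₀} is order-equivalent to
-- L̃_γ and x₀ is not on the chain of L_γ, the chain of L_γ is the image of the chain of L̃_γ
-- and ∂ keeps the two order-equivalent.  By induction this holds for all γ, and
-- standardization identifies order-equivalent labelings.

module Submission where

open import Defs
open import Level using (0ℓ)
open import Data.Nat using (ℕ; zero; suc; _<_; _≤_; _∸_; z≤n; s≤s; _<?_; _<ᵇ_; _+_)
open import Data.Nat.Properties
  using (_≟_; ≤-refl; ≤-reflexive; ≤-trans; ≤-antisym; ≤-pred; <-irrefl; <-asym; <-trans; <-≤-trans; <-cmp;
         <⇒≤; <⇒≢; <⇒≯; <⇒≱; ≮⇒≥; ≤∧≢⇒<; 1+n≰n; m<n⇒m<1+n; m≤n⇒m<n∨m≡n; +-comm; +-suc;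
         m∸n≤m; ∸-monoˡ-<; ∸-cancelʳ-≡; m<n⇒0<n∸m; pred-cancel-<; <ᵇ-reflects-<; ≡ᵇ⇒≡; ≡⇒≡ᵇ)
open import Data.Bool as Bool using (true; false; if_then_else_; T)
open import Data.Unit using (tt)
open import Data.Product using (_×_; _,_; proj₁; proj₂; ∃; ∃₂)
open import Data.Sum using (_⊎_; inj₁; inj₂; [_,_])
open import Data.Maybe as Maybe using (Maybe; just; nothing)
open import Data.Maybe.Properties using (just-injective)
open import Data.Fin using (Fin; fromℕ<; punchIn; punchOut) renaming (_≟_ to _≟F_)
open import Data.Fin.Properties
  using (any?; fromℕ<-injective; punchOut-injective; punchIn-injective; punchIn-punchOut; injective⇒≤)
open import Data.List using (List; []; _∷_; allFin; filter; length; map)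
open import Data.List.Properties
  using (length-tabulate; filter-notAll; filter-≐; filter-accept; filter-reject; filter-none)
open import Data.List.Membership.Propositional using (_∈_; _∉_)
open import Data.List.Membership.Propositional.Properties using (∈-allFin; ∈-filter⁺)
open import Data.List.Relation.Unary.Any as Any using (here; there)
open import Data.List.Relation.Unary.All as All using (All; []; _∷_)
open import Data.List.Relation.Unary.AllPairs using ([]; _∷_)
open import Data.List.Relation.Unary.Unique.Propositional using (Unique)
open import Data.List.Relation.Unary.Unique.Propositional.Properties using (allFin⁺)
open import Function using (id; _∘_; _⇔_; mk⇔; Equivalence; Injective)
open import Relation.Nullary using (¬_; Dec; yes; no; does; contradiction)
open import Relation.Nullary.Reflects using (ofʸ; ofⁿ)
open import Relation.Unary using (Pred; Decidable; _≐_; _∪_)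
open import Relation.Binary using (DecidableEquality; tri<; tri≈; tri>)
open import Relation.Binary.PropositionalEquality hiding ([_])

open Equivalence using (to; from)

module _ {A : Set} {P Q : Pred A 0ℓ} (P? : Decidable P) (Q? : Decidable Q)
         (P⇒Q : ∀ {x} → P x → Q x) where

  filter-filter-weaker : ∀ xs → filter P? (filter Q? xs) ≡ filter P? xs
  filter-filter-weaker [] = refl
  filter-filter-weaker (x ∷ xs) with Q? x
  ... | no ¬q = trans (filter-filter-weaker xs) (sym (filter-reject P? (¬q ∘ P⇒Q)))
  ... | yes _ with P? x
  ...   | yes _ = cong (x ∷_) (filter-filter-weaker xs)
  ...   | no _  = filter-filter-weaker xs

  length-filter-strictMono : ∀ {z} xs → z ∈ xs → Q z → ¬ P z →
                             length (filter P? xs) < length (filter Q? xs)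
  length-filter-strictMono xs z∈xs qz ¬pz =
    subst (λ ys → length ys < _) (filter-filter-weaker xs)
      (filter-notAll P? (filter Q? xs) (Any.map (λ { refl → ¬pz }) (∈-filter⁺ Q? z∈xs qz)))

length-filter-allFin-< : ∀ {m} {P : Pred (Fin m) 0ℓ} (P? : Decidable P) {z} → ¬ P z →
                         length (filter P? (allFin m)) < m
length-filter-allFin-< {m} P? {z} ¬pz = subst (length (filter P? (allFin m)) <_) (length-tabulate id)
  (filter-notAll P? (allFin m) (Any.map (λ { refl → ¬pz }) (∈-allFin z)))

module _ {A : Set} {P Q R : Pred A 0ℓ} (P? : Decidable P) (Q? : Decidable Q) (R? : Decidable R)
         (R≐P∪Q : R ≐ P ∪ Q) (P∩Q=∅ : ∀ {x} → P x → ¬ Q x) where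

  length-filter-∪ : ∀ xs → length (filter R? xs) ≡ length (filter P? xs) + length (filter Q? xs)
  length-filter-∪ [] = refl
  length-filter-∪ (x ∷ xs) with ih ← length-filter-∪ xs | R? x | P? x | Q? x
  ... | _     | yes p | yes q = contradiction q (P∩Q=∅ p)
  ... | yes _ | yes _ | no _  = cong suc ih
  ... | yes _ | no _  | yes _ = trans (cong suc ih) (sym (+-suc _ _))
  ... | yes r | no ¬p | no ¬q = contradiction (proj₁ R≐P∪Q r) [ ¬p , ¬q ]
  ... | no ¬r | yes p | _     = contradiction (proj₂ R≐P∪Q (inj₁ p)) ¬r
  ... | no ¬r | _     | yes q = contradiction (proj₂ R≐P∪Q (inj₂ q)) ¬r
  ... | no _  | no _  | no _  = ih

module _ {A : Set} (_≟_ : DecidableEquality A) where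

  length-filter-≟-unique : ∀ {z xs} → Unique xs → z ∈ xs → length (filter (_≟ z) xs) ≡ 1
  length-filter-≟-unique {xs = x ∷ xs} (x∉xs ∷ _) (here refl)
    rewrite filter-accept (_≟ x) {xs = xs} refl
          | filter-none (_≟ x) (All.map (λ x≢y y≡x → x≢y (sym y≡x)) x∉xs) = refl
  length-filter-≟-unique {xs = x ∷ xs} (x∉xs ∷ u) (there z∈xs)
    rewrite filter-reject (_≟ _) {xs = xs} (All.lookup x∉xs z∈xs) = length-filter-≟-unique u z∈xs

SameOrder : {A : Set} → (A → ℕ) → (A → ℕ) → Set
SameOrder f g = ∀ a b → f a < f b ⇔ g a < g b

module _ {A : Set} {f g : A → ℕ} where

  strictMono⇒sameOrder : Injective _≡_ _≡_ f → (∀ a b → f a < f b → g a < g b) → SameOrder f g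
  strictMono⇒sameOrder f-inj mono a b = mk⇔ (mono a b) reflect
    where
    reflect : g a < g b → f a < f b
    reflect gab with <-cmp (f a) (f b)
    ... | tri< fab _ _ = fab
    ... | tri≈ _ fa≡fb _ = contradiction (cong g (f-inj fa≡fb)) (<⇒≢ gab)
    ... | tri> _ _ fba = contradiction (mono b a fba) (<⇒≯ gab)

  sameOrder-injective : SameOrder f g → Injective _≡_ _≡_ f → Injective _≡_ _≡_ g
  sameOrder-injective f∼g f-inj {a} {b} ga≡gb with <-cmp (f a) (f b)
  ... | tri< fab _ _ = contradiction ga≡gb (<⇒≢ (to (f∼g a b) fab))
  ... | tri≈ _ fa≡fb _ = f-inj fa≡fb
  ... | tri> _ _ fba = contradiction (sym ga≡gb) (<⇒≢ (to (f∼g b a) fba))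

  sameOrder-resp-≗ : ∀ {f′ g′ : A → ℕ} → f ≗ f′ → g ≗ g′ → SameOrder f g → SameOrder f′ g′
  sameOrder-resp-≗ f≗f′ g≗g′ f∼g a b = mk⇔
    (subst₂ _<_ (g≗g′ a) (g≗g′ b) ∘ to (f∼g a b) ∘ subst₂ _<_ (sym (f≗f′ a)) (sym (f≗f′ b)))
    (subst₂ _<_ (f≗f′ a) (f≗f′ b) ∘ from (f∼g a b) ∘ subst₂ _<_ (sym (g≗g′ a)) (sym (g≗g′ b)))

InRange : {A : Set} → ℕ → (A → ℕ) → Set
InRange m f = ∀ x → 1 ≤ f x × f x ≤ m

pred-< : ∀ {a n} → 1 ≤ a × a ≤ n → a ∸ 1 < n
pred-< {suc a} (_ , a<n) = a<n

labelIndex : ∀ {a n} → 1 ≤ a × a ≤ n → Fin n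
labelIndex {suc a} (_ , a<n) = fromℕ< a<n

labelIndex-injective : ∀ {a b n} (p : 1 ≤ a × a ≤ n) (q : 1 ≤ b × b ≤ n) →
                       labelIndex p ≡ labelIndex q → a ≡ b
labelIndex-injective {suc a} {suc b} (_ , a<n) (_ , b<n) eq = cong suc (fromℕ<-injective a b a<n b<n eq)

injective∧inRange⇒surjective : ∀ {m} (g : Fin m → ℕ) → Injective _≡_ _≡_ g → InRange m g →
                               ∀ k → 1 ≤ k → k ≤ m → ∃ λ x → g x ≡ k
injective∧inRange⇒surjective {suc m} g g-inj range (suc k) _ k<m with any? (λ x → g x ≟ suc k)
... | yes hit = hit
... | no miss = contradiction (injective⇒≤ h-injective) 1+n≰n
  where
  -- otherwise g, read as a map into the labels other than k, would inject Fin (suc m) into Fin m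
  k≢g : ∀ x → labelIndex (s≤s z≤n , k<m) ≢ labelIndex (range x)
  k≢g x eq = miss (x , sym (labelIndex-injective (s≤s z≤n , k<m) (range x) eq))
  h : Fin (suc m) → Fin m
  h x = punchOut (k≢g x)
  h-injective : Injective _≡_ _≡_ h
  h-injective {x} {y} eq =
    g-inj (labelIndex-injective (range x) (range y) (punchOut-injective (k≢g x) (k≢g y) eq))

injective∧inRange⇒isLabeling : ∀ {m} (g : Fin m → ℕ) → Injective _≡_ _≡_ g → InRange m g →
                               IsLabeling m g
injective∧inRange⇒isLabeling g g-inj range =
  g-inj , range , injective∧inRange⇒surjective g g-inj range

module _ {m : ℕ} where

  st-cong : {f g : Fin m → ℕ} → SameOrder f g → ∀ y → st f y ≡ st g y
  st-cong f∼g y = cong (suc ∘ length)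
    (filter-≐ (λ z → _ <? _) (λ z → _ <? _) ((λ {z} → to (f∼g z y)) , (λ {z} → from (f∼g z y))) (allFin m))

  st-strictMono : (f : Fin m → ℕ) → ∀ a b → f a < f b → st f a < st f b
  st-strictMono f a b fab = s≤s (length-filter-strictMono (λ z → f z <? f a) (λ z → f z <? f b)
    (λ fza → <-trans fza fab) (allFin m) (∈-allFin a) fab (<-irrefl refl))

  st-sameOrder : (f : Fin m → ℕ) → Injective _≡_ _≡_ f → SameOrder f (st f)
  st-sameOrder f f-inj = strictMono⇒sameOrder f-inj (st-strictMono f)

  st-inRange : (f : Fin m → ℕ) → InRange m (st f)
  st-inRange f y = s≤s z≤n , length-filter-allFin-< (λ z → f z <? f y) (<-irrefl refl)

  st-isLabeling : (f : Fin m → ℕ) → Injective _≡_ _≡_ f → IsLabeling m (st f)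
  st-isLabeling f f-inj = injective∧inRange⇒isLabeling (st f)
    (sameOrder-injective (st-sameOrder f f-inj) f-inj) (st-inRange f)

  length-filter-label-≟ : {g : Fin m → ℕ} → IsLabeling m g → ∀ {k} → 1 ≤ k → k ≤ m →
                          length (filter (λ z → g z ≟ k) (allFin m)) ≡ 1
  length-filter-label-≟ {g} (g-inj , _ , g-onto) {k} 1≤k k≤m with z₀ , gz₀≡k ← g-onto k 1≤k k≤m =
    trans (cong length (filter-≐ (λ z → g z ≟ k) (_≟F z₀) (g≡k⇒≡z₀ , λ { refl → gz₀≡k }) (allFin m)))
          (length-filter-≟-unique _≟F_ (allFin⁺ m) (∈-allFin z₀))
    where
    g≡k⇒≡z₀ : ∀ {z} → g z ≡ k → z ≡ z₀
    g≡k⇒≡z₀ gz≡k = g-inj (trans gz≡k (sym gz₀≡k))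

  length-filter-label-< : {g : Fin m → ℕ} → IsLabeling m g → ∀ k → k ≤ m →
                          length (filter (λ z → g z <? suc k) (allFin m)) ≡ k
  length-filter-label-< {g} (_ , range , _) zero _ = cong length
    (filter-none (λ z → g z <? 1) {xs = allFin m} (All.tabulate (λ {z} _ → <⇒≱ (proj₁ (range z)) ∘ ≤-pred)))
  length-filter-label-< {g} lab (suc k) 1+k≤m = begin
    length (filter (λ z → g z <? suc (suc k)) (allFin m))
      ≡⟨ length-filter-∪ (λ z → g z <? suc k) (λ z → g z ≟ suc k) (λ z → g z <? suc (suc k))
           ((m≤n⇒m<n∨m≡n ∘ ≤-pred) , [ m<n⇒m<1+n , ≤-reflexive ∘ cong suc ]) (λ lt eq → <-irrefl eq lt)
           (allFin m) ⟩
    length (filter (λ z → g z <? suc k) (allFin m)) + length (filter (λ z → g z ≟ suc k) (allFin m))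
      ≡⟨ cong₂ _+_ (length-filter-label-< lab k (<⇒≤ 1+k≤m))
                   (length-filter-label-≟ lab (s≤s z≤n) 1+k≤m) ⟩
    k + 1
      ≡⟨ +-comm k 1 ⟩
    suc k ∎
    where open ≡-Reasoning

  st-labeling : {g : Fin m → ℕ} → IsLabeling m g → ∀ y → st g y ≡ g y
  st-labeling {g} lab@(_ , range , _) y with g y | range y
  ... | suc v | _ , 1+v≤m = cong suc (length-filter-label-< lab v (<⇒≤ 1+v≤m))

-- The element whose label, minus one, x receives under relabel; nothing means x gets the top label.
relabelSource : ∀ {N} → List (Fin N) → Fin N → Maybe (Fin N)
relabelSource []           x = just x
relabelSource (v ∷ [])     x = if does (v ≟F x) then nothing else just x
relabelSource (v ∷ w ∷ vs) x = if does (v ≟F x) then just w else relabelSource (w ∷ vs) x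

sourceLabel : {A : Set} → ℕ → (A → ℕ) → Maybe A → ℕ
sourceLabel top f nothing  = top
sourceLabel top f (just w) = f w ∸ 1

module _ {N : ℕ} where

  relabelSource-just : ∀ (v : Fin N) vs {x w} → relabelSource (v ∷ vs) x ≡ just w →
                       (w ≡ x × x ∉ v ∷ vs) ⊎ w ∈ vs
  relabelSource-just v [] {x} eq with v ≟F x
  relabelSource-just v [] {x} refl | no v≢x = inj₁ (refl , λ { (here x≡v) → v≢x (sym x≡v) })
  relabelSource-just v (u ∷ vs) {x} eq with v ≟F x
  relabelSource-just v (u ∷ vs) {x} refl | yes _ = inj₂ (here refl)
  ... | no v≢x with relabelSource-just u vs eq
  ...   | inj₁ (w≡x , x∉) = inj₁ (w≡x , λ { (here x≡v) → v≢x (sym x≡v) ; (there x∈) → x∉ x∈ })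
  ...   | inj₂ w∈vs = inj₂ (there w∈vs)

  relabelSource-≢-head : ∀ {v vs} {x : Fin N} → Unique (v ∷ vs) → relabelSource (v ∷ vs) x ≢ just v
  relabelSource-≢-head {v} {vs} (v∉vs ∷ _) eq =
    [ (λ { (refl , x∉) → x∉ (here refl) }) , (λ v∈vs → All.lookup v∉vs v∈vs refl) ]
      (relabelSource-just v vs eq)

  relabelSource-injective : ∀ {vs : List (Fin N)} → Unique vs →
                            ∀ {x y} → relabelSource vs x ≡ relabelSource vs y → x ≡ y
  relabelSource-injective {[]} _ refl = refl
  relabelSource-injective {v ∷ []} _ {x} {y} eq with v ≟F x | v ≟F y
  ... | yes v≡x | yes v≡y = trans (sym v≡x) v≡y
  ... | no _    | no _    = just-injective eq
  relabelSource-injective {v ∷ w ∷ vs} (_ ∷ u) {x} {y} eq with v ≟F x | v ≟F y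
  ... | yes v≡x | yes v≡y = trans (sym v≡x) v≡y
  ... | yes _   | no _    = contradiction (sym eq) (relabelSource-≢-head u)
  ... | no _    | yes _   = contradiction eq (relabelSource-≢-head u)
  ... | no _    | no _    = relabelSource-injective u eq

module _ {N M} (ι : Fin N → Fin M) (ι-inj : Injective _≡_ _≡_ ι) where

  relabelSource-map : ∀ vs x → relabelSource (map ι vs) (ι x) ≡ Maybe.map ι (relabelSource vs x)
  relabelSource-map [] x = refl
  relabelSource-map (v ∷ []) x with v ≟F x | ι v ≟F ι x
  ... | yes _   | yes _    = refl
  ... | yes v≡x | no ιv≢ιx = contradiction (cong ι v≡x) ιv≢ιx
  ... | no v≢x  | yes ιv≡ιx = contradiction (ι-inj ιv≡ιx) v≢x
  ... | no _    | no _     = refl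
  relabelSource-map (v ∷ vs@(_ ∷ _)) x with ih ← relabelSource-map vs x | v ≟F x | ι v ≟F ι x
  ... | yes _   | yes _    = refl
  ... | yes v≡x | no ιv≢ιx = contradiction (cong ι v≡x) ιv≢ιx
  ... | no v≢x  | yes ιv≡ιx = contradiction (ι-inj ιv≡ιx) v≢x
  ... | no _    | no _     = ih

module _ {A : Set} {top : ℕ} {f : A → ℕ} (f-range : InRange top f) where

  sourceLabel-injective : Injective _≡_ _≡_ f → Injective _≡_ _≡_ (sourceLabel top f)
  sourceLabel-injective f-inj {nothing} {nothing} _  = refl
  sourceLabel-injective f-inj {nothing} {just b}  eq = contradiction (sym eq) (<⇒≢ (pred-< (f-range b)))
  sourceLabel-injective f-inj {just a}  {nothing} eq = contradiction eq (<⇒≢ (pred-< (f-range a)))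
  sourceLabel-injective f-inj {just a}  {just b}  eq =
    cong just (f-inj (∸-cancelʳ-≡ (proj₁ (f-range a)) (proj₁ (f-range b)) eq))

  sourceLabel-strictMono : ∀ {top′} {g : A → ℕ} → InRange top′ g → (∀ a b → f a < f b → g a < g b) →
                           ∀ ma mb → sourceLabel top f ma < sourceLabel top f mb →
                           sourceLabel top′ g ma < sourceLabel top′ g mb
  sourceLabel-strictMono g-range mono nothing  nothing  lt = contradiction lt (<-irrefl refl)
  sourceLabel-strictMono g-range mono nothing  (just b) lt = contradiction lt (<-asym (pred-< (f-range b)))
  sourceLabel-strictMono g-range mono (just a) nothing  _  = pred-< (g-range a)
  sourceLabel-strictMono g-range mono (just a) (just b) lt =
    ∸-monoˡ-< (mono a b (pred-cancel-< lt)) (proj₁ (g-range a))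

sourceLabel-map : ∀ {A B : Set} {top} (f : B → ℕ) (ι : A → B) ma →
                  sourceLabel top f (Maybe.map ι ma) ≡ sourceLabel top (f ∘ ι) ma
sourceLabel-map f ι nothing  = refl
sourceLabel-map f ι (just a) = refl

sourceLabel-sameOrder : ∀ {A : Set} {m n} {f g : A → ℕ} → InRange m f → InRange n g → SameOrder f g →
                        SameOrder (sourceLabel m f) (sourceLabel n g)
sourceLabel-sameOrder f-range g-range f∼g ma mb = mk⇔
  (sourceLabel-strictMono f-range g-range (λ a b → to (f∼g a b)) ma mb)
  (sourceLabel-strictMono g-range f-range (λ a b → from (f∼g a b)) ma mb)

module PromotionProperties {N : ℕ} (Q : FinPoset N) where
  open FinPoset Q using (_≼_) renaming (_≤?_ to _≼?_; trans to ≼-trans; antisym to ≼-antisym)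
  open Promotion Q hiding (chain; ∂; ∂^)

  _≺_ : Fin N → Fin N → Set
  v ≺ w = above? v w ≡ true

  _≺?_ : ∀ v w → Dec (v ≺ w)
  v ≺? w = above? v w Bool.≟ true

  ≺⇒≼∧≢ : ∀ {v w} → v ≺ w → v ≼ w × v ≢ w
  ≺⇒≼∧≢ {v} {w} v≺w with v ≼? w | v ≟F w | v≺w
  ... | yes v≼w | no v≢w | _ = v≼w , v≢w
  ... | yes _   | yes _  | ()
  ... | no _    | _      | ()

  ≼∧≢⇒≺ : ∀ {v w} → v ≼ w → v ≢ w → v ≺ w
  ≼∧≢⇒≺ {v} {w} v≼w v≢w with v ≼? w | v ≟F w
  ... | yes _   | no _    = refl
  ... | yes _   | yes v≡w = contradiction v≡w v≢w
  ... | no v⋠w  | _       = contradiction v≼w v⋠w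

  ≺-irrefl : ∀ {v} → ¬ v ≺ v
  ≺-irrefl v≺v = proj₂ (≺⇒≼∧≢ v≺v) refl

  ≺-trans : ∀ {u v w} → u ≺ v → v ≺ w → u ≺ w
  ≺-trans u≺v v≺w with ≺⇒≼∧≢ u≺v | ≺⇒≼∧≢ v≺w
  ... | u≼v , u≢v | v≼w , _ = ≼∧≢⇒≺ (≼-trans u≼v v≼w) (λ { refl → u≢v (≼-antisym u≼v v≼w) })

  data LeastAbove (f : Fin N → ℕ) (v : Fin N) (ys : List (Fin N)) : Maybe (Fin N) → Set where
    none  : (∀ {y} → y ∈ ys → ¬ v ≺ y) → LeastAbove f v ys nothing
    least : ∀ {w} → v ≺ w → (∀ {y} → y ∈ ys → v ≺ y → f w ≤ f y) → LeastAbove f v ys (just w)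

  minAboveIn-spec : ∀ f v ys → LeastAbove f v ys (minAboveIn f v ys)
  minAboveIn-spec f v [] = none (λ ())
  minAboveIn-spec f v (y ∷ ys) with above? v y in above-v-y | minAboveIn f v ys | minAboveIn-spec f v ys
  ... | false | _ | none ¬above = none λ
    { (here refl) v≺y → contradiction (trans (sym above-v-y) v≺y) λ () ; (there y∈) → ¬above y∈ }
  ... | false | _ | least v≺w min = least v≺w λ
    { (here refl) v≺y → contradiction (trans (sym above-v-y) v≺y) λ () ; (there y∈) → min y∈ }
  ... | true | _ | none ¬above = least above-v-y λ
    { (here refl) _ → ≤-refl ; (there y∈) v≺y′ → contradiction v≺y′ (¬above y∈) }
  ... | true | just w | least v≺w min with f y <ᵇ f w | <ᵇ-reflects-< (f y) (f w)
  ...   | true  | ofʸ y<w = least above-v-y λ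
    { (here refl) _ → ≤-refl ; (there y∈) v≺y′ → ≤-trans (<⇒≤ y<w) (min y∈ v≺y′) }
  ...   | false | ofⁿ y≮w = least v≺w λ
    { (here refl) _ → ≮⇒≥ y≮w ; (there y∈) → min y∈ }

  minAbove-spec : ∀ f v → LeastAbove f v (allFin N) (minAbove f v)
  minAbove-spec f v = minAboveIn-spec f v (allFin N)

  findFirst-just : ∀ p xs {x} → findFirst p xs ≡ just x → T (p x)
  findFirst-just p (y ∷ ys) eq with p y in py
  findFirst-just p (y ∷ ys) refl | true = subst T (sym py) tt
  ... | false = findFirst-just p ys eq

  findFirst-nothing : ∀ p {xs x} → findFirst p xs ≡ nothing → x ∈ xs → ¬ T (p x)
  findFirst-nothing p {y ∷ ys} eq x∈ with p y in py
  findFirst-nothing p {y ∷ ys} eq (here refl) | false = subst (¬_ ∘ T) (sym py) λ ()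
  findFirst-nothing p {y ∷ ys} eq (there x∈) | false = findFirst-nothing p eq x∈

  labelOne-labeling : ∀ {f} → IsLabeling N f → Fin N → ∃ λ v → labelOne f ≡ just v × f v ≡ 1
  labelOne-labeling {f} (_ , range , onto) z with labelOne f in eq
  ... | just v  = v , refl , ≡ᵇ⇒≡ (f v) 1 (findFirst-just _ (allFin N) eq)
  ... | nothing = contradiction (≡⇒≡ᵇ (f (proj₁ one)) 1 (proj₂ one))
                                (findFirst-nothing _ eq (∈-allFin (proj₁ one)))
    where
    one : ∃ λ w → f w ≡ 1
    one = onto 1 ≤-refl (≤-trans (proj₁ (range z)) (proj₂ (range z)))

  chain-≡-chainFrom : ∀ {f v} → labelOne f ≡ just v → chain Q f ≡ chainFrom f N v
  chain-≡-chainFrom {f} eq with labelOne f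
  chain-≡-chainFrom refl | just _ = refl

  chainFrom-head : ∀ f k v → ∃ λ vs → chainFrom f k v ≡ v ∷ vs
  chainFrom-head f zero v = [] , refl
  chainFrom-head f (suc k) v with minAbove f v
  ... | nothing = [] , refl
  ... | just w  = chainFrom f k w , refl

  chainFrom-step : ∀ f k {v w} → minAbove f v ≡ just w → chainFrom f (suc k) v ≡ v ∷ chainFrom f k w
  chainFrom-step f k {v} eq with minAbove f v
  chainFrom-step f k refl | just _ = refl

  chainFrom-∋ : ∀ f k v → v ∈ chainFrom f k v
  chainFrom-∋ f k v with vs , hd ← chainFrom-head f k v = subst (v ∈_) (sym hd) (here refl)

  minAbove-∉ : ∀ f k v {x} → x ∉ chainFrom f (suc k) v → minAbove f v ≢ just x
  minAbove-∉ f k v x∉ with minAbove f v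
  ... | just w = λ { refl → x∉ (there (chainFrom-∋ f k w)) }

  labelOne-∈-chain : ∀ {f v} → labelOne f ≡ just v → v ∈ chain Q f
  labelOne-∈-chain {f} {v} eq = subst (v ∈_) (sym (chain-≡-chainFrom eq)) (chainFrom-∋ f N v)

  chainFrom-above : ∀ f k {v w} → v ≺ w → All (v ≺_) (chainFrom f k w)
  chainFrom-above f zero v≺w = v≺w ∷ []
  chainFrom-above f (suc k) {w = w} v≺w with minAbove f w | minAbove-spec f w
  ... | nothing | _            = v≺w ∷ []
  ... | just _  | least w≺w′ _ = v≺w ∷ chainFrom-above f k (≺-trans v≺w w≺w′)

  chainFrom-unique : ∀ f k v → Unique (chainFrom f k v)
  chainFrom-unique f zero v = [] ∷ []
  chainFrom-unique f (suc k) v with minAbove f v | minAbove-spec f v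
  ... | nothing | _           = [] ∷ []
  ... | just w  | least v≺w _ =
    All.map (λ { v≺v refl → ≺-irrefl v≺v }) (chainFrom-above f k v≺w) ∷ chainFrom-unique f k w

  chain-unique : ∀ f → Unique (chain Q f)
  chain-unique f with labelOne f
  ... | nothing = []
  ... | just v  = chainFrom-unique f N v

  chain-labeling : ∀ {f} → IsLabeling N f → Fin N → ∃₂ λ v vs → chain Q f ≡ v ∷ vs × f v ≡ 1
  chain-labeling {f} f-lab z with labelOne-labeling f-lab z
  ... | v , eq , fv≡1 with chainFrom-head f N v
  ...   | vs , hd = v , vs , trans (chain-≡-chainFrom eq) hd , fv≡1

  height : Fin N → ℕ
  height v = length (filter (v ≺?_) (allFin N))

  height-≺ : ∀ {v w} → v ≺ w → height w < height v
  height-≺ {v} {w} v≺w = length-filter-strictMono (w ≺?_) (v ≺?_) (≺-trans v≺w) (allFin N)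
    (∈-allFin w) v≺w ≺-irrefl

  height-< : ∀ v → height v < N
  height-< v = length-filter-allFin-< (v ≺?_) ≺-irrefl

  chainFrom-suc : ∀ f k v → height v ≤ k → chainFrom f (suc k) v ≡ chainFrom f k v
  chainFrom-suc f zero v h with minAbove f v | minAbove-spec f v
  ... | nothing | _           = refl
  ... | just w  | least v≺w _ = contradiction (<-≤-trans (height-≺ v≺w) h) λ ()
  chainFrom-suc f (suc k) v h with minAbove f v | minAbove-spec f v
  ... | nothing | _           = refl
  ... | just w  | least v≺w _ = cong (v ∷_) (chainFrom-suc f k w (≤-pred (<-≤-trans (height-≺ v≺w) h)))

  relabel-source : ∀ f vs x → relabel f vs x ≡ sourceLabel N f (relabelSource vs x)
  relabel-source f [] x = refl
  relabel-source f (v ∷ []) x with v ≟F x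
  ... | yes _ = refl
  ... | no _  = refl
  relabel-source f (v ∷ vs@(_ ∷ _)) x with ih ← relabel-source f vs x | v ≟F x
  ... | yes _ = refl
  ... | no _  = ih

  relabel-inRange : ∀ {f v vs} → IsLabeling N f → Unique (v ∷ vs) → f v ≡ 1 → InRange N (relabel f (v ∷ vs))
  relabel-inRange {f} {v} {vs} (f-inj , f-range , _) u fv≡1 x
    rewrite relabel-source f (v ∷ vs) x with relabelSource (v ∷ vs) x in src
  ... | nothing = ≤-trans (proj₁ (f-range x)) (proj₂ (f-range x)) , ≤-refl
  ... | just w  = m<n⇒0<n∸m (≤∧≢⇒< (proj₁ (f-range w)) 1≢fw) ,
                  ≤-trans (m∸n≤m (f w) 1) (proj₂ (f-range w))
    where
    1≢fw : 1 ≢ f w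
    1≢fw 1≡fw = relabelSource-≢-head u (trans src (cong just (f-inj (trans (sym 1≡fw) (sym fv≡1)))))

  ∂-preserves-labeling : ∀ {f} → IsLabeling N f → IsLabeling N (∂ Q f)
  ∂-preserves-labeling {f} f-lab@(f-inj , f-range , _) = injective∧inRange⇒isLabeling (∂ Q f) ∂-inj ∂-range
    where
    ∂-inj : Injective _≡_ _≡_ (∂ Q f)
    ∂-inj {x} {y} eq = relabelSource-injective (chain-unique f) (sourceLabel-injective f-range f-inj
      (trans (sym (relabel-source f (chain Q f) x)) (trans eq (relabel-source f (chain Q f) y))))
    ∂-range : InRange N (∂ Q f)
    ∂-range x with chain-labeling f-lab x
    ... | v , vs , c≡v∷vs , fv≡1 = subst (λ c → InRange N (relabel f c)) (sym c≡v∷vs)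
      (relabel-inRange f-lab (subst Unique c≡v∷vs (chain-unique f)) fv≡1) x

  ∂^-preserves-labeling : ∀ γ {f} → IsLabeling N f → IsLabeling N (∂^ Q γ f)
  ∂^-preserves-labeling zero    f-lab = f-lab
  ∂^-preserves-labeling (suc γ) f-lab = ∂-preserves-labeling (∂^-preserves-labeling γ f-lab)

module DeletePoint {n : ℕ} (P : FinPoset (suc n)) (x₀ : Fin (suc n)) where

  P̃ : FinPoset n
  P̃ = deletePt P x₀

  ι : Fin n → Fin (suc n)
  ι = punchIn x₀

  ι-injective : Injective _≡_ _≡_ ι
  ι-injective = punchIn-injective x₀ _ _

  ι-onto : ∀ {w} → w ≢ x₀ → ∃ λ u → ι u ≡ w
  ι-onto w≢x₀ = punchOut (w≢x₀ ∘ sym) , punchIn-punchOut _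

  private
    module A  = Promotion P
    module Ã  = Promotion P̃
    module PA = PromotionProperties P
    module PÃ = PromotionProperties P̃
  open FinPoset P using () renaming (_≤?_ to _≼?_)

  above?-punchIn : ∀ u w → Ã.above? u w ≡ A.above? (ι u) (ι w)
  above?-punchIn u w with ι u ≼? ι w | u ≟F w | ι u ≟F ι w
  ... | yes _ | yes _   | yes _     = refl
  ... | yes _ | yes u≡w | no ιu≢ιw  = contradiction (cong ι u≡w) ιu≢ιw
  ... | yes _ | no u≢w  | yes ιu≡ιw = contradiction (ι-injective ιu≡ιw) u≢w
  ... | yes _ | no _    | no _      = refl
  ... | no _  | _       | _         = refl

  ≺-punchIn⁺ : ∀ {u w} → u PÃ.≺ w → ι u PA.≺ ι w
  ≺-punchIn⁺ {u} {w} = trans (sym (above?-punchIn u w))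

  ≺-punchIn⁻ : ∀ {u w} → ι u PA.≺ ι w → u PÃ.≺ w
  ≺-punchIn⁻ {u} {w} = trans (above?-punchIn u w)

  module _ {L : Fin (suc n) → ℕ} {K : Fin n → ℕ}
           (L-lab : IsLabeling (suc n) L) (K-lab : IsLabeling n K) (L∼K : SameOrder (L ∘ ι) K) where

    private
      K-inj : Injective _≡_ _≡_ K
      K-inj = proj₁ K-lab
      L-range : InRange (suc n) L
      L-range = proj₁ (proj₂ L-lab)
      K-range : InRange n K
      K-range = proj₁ (proj₂ K-lab)

    minAbove-punchIn : ∀ u → A.minAbove L (ι u) ≢ just x₀ →
                       A.minAbove L (ι u) ≡ Maybe.map ι (Ã.minAbove K u)
    minAbove-punchIn u ≢x₀ with A.minAbove L (ι u) | PA.minAbove-spec L (ι u)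
    minAbove-punchIn u ≢x₀ | nothing | PA.none ¬above with Ã.minAbove K u | PÃ.minAbove-spec K u
    ... | nothing | _              = refl
    ... | just m  | PÃ.least u≺m _ = contradiction (≺-punchIn⁺ u≺m) (¬above (∈-allFin (ι m)))
    minAbove-punchIn u ≢x₀ | just w | PA.least ιu≺w minL
      with w′ , refl ← ι-onto (λ w≡x₀ → ≢x₀ (cong just w≡x₀))
      with Ã.minAbove K u | PÃ.minAbove-spec K u
    ... | nothing | PÃ.none ¬above = contradiction (≺-punchIn⁻ ιu≺w) (¬above (∈-allFin w′))
    ... | just m  | PÃ.least u≺m minK = cong (just ∘ ι) (K-inj (≤-antisym Kw′≤Km Km≤Kw′))
      where
      Km≤Kw′ : K m ≤ K w′
      Km≤Kw′ = minK (∈-allFin w′) (≺-punchIn⁻ ιu≺w)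
      Kw′≤Km : K w′ ≤ K m
      Kw′≤Km = ≮⇒≥ λ Km<Kw′ → <⇒≱ (from (L∼K m w′) Km<Kw′)
        (minL (∈-allFin (ι m)) (≺-punchIn⁺ u≺m))

    chainFrom-punchIn : ∀ k u → x₀ ∉ A.chainFrom L k (ι u) →
                        A.chainFrom L k (ι u) ≡ map ι (Ã.chainFrom K k u)
    chainFrom-punchIn zero u _ = refl
    chainFrom-punchIn (suc k) u x₀∉
      with A.minAbove L (ι u) in next | Ã.minAbove K u | minAbove-punchIn u (PA.minAbove-∉ L k (ι u) x₀∉)
    ... | nothing | nothing | _    = refl
    ... | just _  | just m  | refl = cong (ι u ∷_)
      (chainFrom-punchIn k m (x₀∉ ∘ subst (x₀ ∈_) (sym (PA.chainFrom-step L k next)) ∘ there))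

    label-one-punchIn : ∀ {u u₁} → L (ι u) ≡ 1 → K u₁ ≡ 1 → u ≡ u₁
    label-one-punchIn {u} {u₁} Lιu≡1 Ku₁≡1 = K-inj (≤-antisym Ku≤Ku₁ Ku₁≤Ku)
      where
      Ku₁≤Ku : K u₁ ≤ K u
      Ku₁≤Ku = subst (_≤ K u) (sym Ku₁≡1) (proj₁ (K-range u))
      Ku≤Ku₁ : K u ≤ K u₁
      Ku≤Ku₁ = ≮⇒≥ λ Ku₁<Ku → <⇒≱ (from (L∼K u₁ u) Ku₁<Ku)
        (subst (_≤ L (ι u₁)) (sym Lιu≡1) (proj₁ (L-range (ι u₁))))

    chain-punchIn : x₀ ∉ chain P L → chain P L ≡ map ι (chain P̃ K)
    chain-punchIn x₀∉
      with v , first-L , Lv≡1 ← PA.labelOne-labeling L-lab x₀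
      with u , refl ← ι-onto {v} (λ { refl → x₀∉ (PA.labelOne-∈-chain {L} first-L) })
      with u₁ , first-K , Ku₁≡1 ← PÃ.labelOne-labeling K-lab u
      with refl ← label-one-punchIn Lv≡1 Ku₁≡1 = begin
      chain P L                   ≡⟨ chain-L ⟩
      A.chainFrom L n (ι u)       ≡⟨ chainFrom-punchIn n u (x₀∉ ∘ subst (x₀ ∈_) (sym chain-L)) ⟩
      map ι (Ã.chainFrom K n u)   ≡⟨ cong (map ι) (PÃ.chain-≡-chainFrom first-K) ⟨
      map ι (chain P̃ K)           ∎
      where
      open ≡-Reasoning
      -- `chain` runs with fuel suc n in P but only n in P̃; every height is below suc n, so the extra step is idle.
      chain-L : chain P L ≡ A.chainFrom L n (ι u)
      chain-L = trans (PA.chain-≡-chainFrom first-L) (PA.chainFrom-suc L n (ι u) (≤-pred (PA.height-< (ι u))))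

    ∂-punchIn-sameOrder : x₀ ∉ chain P L → SameOrder (∂ P L ∘ ι) (∂ P̃ K)
    ∂-punchIn-sameOrder x₀∉ = sameOrder-resp-≗ ∂L-source ∂K-source λ a b →
      sourceLabel-sameOrder (L-range ∘ ι) K-range L∼K (source a) (source b)
      where
      open ≡-Reasoning
      source : Fin n → Maybe (Fin n)
      source = relabelSource (chain P̃ K)
      ∂L-source : ∀ z → sourceLabel (suc n) (L ∘ ι) (source z) ≡ ∂ P L (ι z)
      ∂L-source z = begin
        sourceLabel (suc n) (L ∘ ι) (source z)
          ≡⟨ sourceLabel-map L ι (source z) ⟨
        sourceLabel (suc n) L (Maybe.map ι (source z))
          ≡⟨ cong (sourceLabel (suc n) L) (relabelSource-map ι ι-injective (chain P̃ K) z) ⟨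
        sourceLabel (suc n) L (relabelSource (map ι (chain P̃ K)) (ι z))
          ≡⟨ cong (λ c → sourceLabel (suc n) L (relabelSource c (ι z))) (chain-punchIn x₀∉) ⟨
        sourceLabel (suc n) L (relabelSource (chain P L) (ι z))
          ≡⟨ PA.relabel-source L (chain P L) (ι z) ⟨
        ∂ P L (ι z)
          ∎
      ∂K-source : ∀ z → sourceLabel n K (source z) ≡ ∂ P̃ K z
      ∂K-source z = sym (PÃ.relabel-source K (chain P̃ K) z)

  ∂^-punchIn-sameOrder : ∀ {L K} → IsLabeling (suc n) L → IsLabeling n K → SameOrder (L ∘ ι) K →
                         ∀ γ → (∀ i → i < γ → x₀ ∉ chain P (∂^ P i L)) →
                         SameOrder (∂^ P γ L ∘ ι) (∂^ P̃ γ K)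
  ∂^-punchIn-sameOrder L-lab K-lab L∼K zero    _     = L∼K
  ∂^-punchIn-sameOrder L-lab K-lab L∼K (suc γ) avoid =
    ∂-punchIn-sameOrder (PA.∂^-preserves-labeling γ L-lab) (PÃ.∂^-preserves-labeling γ K-lab)
      (∂^-punchIn-sameOrder L-lab K-lab L∼K γ (λ i i<γ → avoid i (m<n⇒m<1+n i<γ))) (avoid γ ≤-refl)

lemma4p12 : {n′ : ℕ} (P : FinPoset (suc n′)) (L : Fin (suc n′) → ℕ) →
    IsLabeling (suc n′) L → (x₀ : Fin (suc n′)) (γ : ℕ) →
    (∀ i → i < γ → x₀ ∉ chain P (∂^ P i L)) →
    ∀ y → st (λ z → ∂^ P γ L (punchIn x₀ z)) y
          ≡ ∂^ (deletePt P x₀) γ (st (λ z → L (punchIn x₀ z))) y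
lemma4p12 {n′} P L L-lab x₀ γ avoid y = begin
  st (∂^ P γ L ∘ ι) y ≡⟨ st-cong (∂^-punchIn-sameOrder L-lab K-lab L∼K γ avoid) y ⟩
  st (∂^ P̃ γ K) y     ≡⟨ st-labeling (PromotionProperties.∂^-preserves-labeling P̃ γ K-lab) y ⟩
  ∂^ P̃ γ K y          ∎
  where
  open ≡-Reasoning
  open DeletePoint P x₀
  Lι-inj : Injective _≡_ _≡_ (L ∘ ι)
  Lι-inj = ι-injective ∘ proj₁ L-lab
  K : Fin n′ → ℕ
  K = st (L ∘ ι)
  K-lab : IsLabeling n′ K
  K-lab = st-isLabeling (L ∘ ι) Lι-inj
  L∼K : SameOrder (L ∘ ι) K
  L∼K = st-sameOrder (L ∘ ι) Lι-inj
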